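{- Suppose consecutive primes satisfy $\sqrt{p_n} - \sqrt{p_{n-1}} = O(1)$, i.e. there is a constant $C>0$ with $\sqrt{p_n} - \sqrt{p_{n-1}} < C$ for all $n \ge 2$. Then there exists a positive integer $M$ such that for every integer $m > M$ there is a prime number $p$ with $m^3 < p < (m+1)^3$.
   Context: $p_1 = 2 < p_2 = 3 < p_3 < \cdots$ denotes the increasing enumeration of all prime numbers, so $p_n$ is the $n$-th prime. -}

module Defs where

open import Data.Nat using (ℕ; _+_; _*_; _∸_; _^_; _<_)
open import Data.Nat.Primality using (Prime)
open import Data.Product using (_×_)
open import Data.Sum using (_⊎_)
open import Relation.Nullary using (¬_)

ConsecutivePrimes : ℕ → ℕ → Set
ConsecutivePrimes q r =
  Prime q × Prime r × q < r × (∀ k → q < k → k < r → ¬ Prime k)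

-- SqrtDiffLt a b C  ⇔  √a − √b < C  (real square roots), for naturals a b C.
-- √a < √b + C  ⇔  a < b + C² + 2C√b, and writing d = a − (b + C²):
-- either a < b + C² (then it holds), or d ≥ 0 and d < 2C√b ⇔ d² < 4C²b.
SqrtDiffLt : ℕ → ℕ → ℕ → Set
SqrtDiffLt a b C = a < b + C * C ⊎ (a ∸ (b + C * C)) ^ 2 < 4 * (C * C) * b

{-# OPTIONS --safe #-}
-- Take m > C² and the consecutive primes q ≤ m³ < r around m³ (they exist: 2 ≤ m³, and by
-- Euclid some prime exceeds m³). Were r ≥ (m + 1)³, then r − q ≥ 3m² + 3m + 1 > C² + 2m², and
-- 2m² = 2√m · √(m³) ≥ 2C√q, so r ≥ (√q + C)², contradicting √r − √q < C. Hence r < (m + 1)³.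
module Submission where

open import Defs
open import Data.Nat using (ℕ; zero; suc; _+_; _*_; _∸_; _^_; _!; _≤_; _<_; z≤n; s≤s; _<?_)
open import Data.Nat.Primality using (Prime; prime?; prime[2]; ¬prime[1])
open import Data.Product using (_×_; _,_; ∃-syntax)
open import Data.Nat.Properties
open import Data.Nat.Divisibility using (_∣_; ∣-trans; m∣m*n; m≤n⇒m!∣n!; ∣m+n∣m⇒∣n; ∣1⇒≡1)
open import Data.Nat.Primality.Factorisation using (factorise)
open import Data.Nat.Solver using (module +-*-Solver)
open import Data.List using ([]; _∷_)
open import Data.List.Relation.Unary.All using (_∷_)
open import Data.Sum using (inj₁; inj₂)
open import Data.Empty using (⊥-elim)
open import Relation.Nullary using (¬_; yes; no)
open import Relation.Unary using (Decidable)
open import Relation.Binary.PropositionalEquality using (_≡_; refl; sym; subst)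

module _ {P : ℕ → Set} (P? : Decidable P) where

  greatest≤ : ∀ {a} X → P a → a ≤ X → ∃[ q ] (P q × q ≤ X × (∀ k → q < k → k ≤ X → ¬ P k))
  greatest≤ X pa a≤X with P? X
  ... | yes pX = X , pX , ≤-refl , λ k X<k k≤X _ → <⇒≱ X<k k≤X
  greatest≤ zero pa z≤n | no ¬p0 = ⊥-elim (¬p0 pa)
  greatest≤ (suc X) pa a≤X | no ¬pX with m≤n⇒m<n∨m≡n a≤X
  ... | inj₂ refl = ⊥-elim (¬pX pa)
  ... | inj₁ (s≤s a≤X′) with greatest≤ X pa a≤X′
  ...   | q , pq , q≤X , none = q , pq , m≤n⇒m≤1+n q≤X , none′
    where
    none′ : ∀ k → q < k → k ≤ suc X → ¬ P k
    none′ k q<k k≤1+X with m≤n⇒m<n∨m≡n k≤1+X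
    ... | inj₁ (s≤s k≤X) = none k q<k k≤X
    ... | inj₂ refl = ¬pX

  least> : ∀ d {X} → P (suc X + d) → ∃[ r ] (P r × X < r × (∀ k → X < k → k < r → ¬ P k))
  least> d {X} p with P? (suc X)
  ... | yes p1+X = suc X , p1+X , ≤-refl , λ k X<k k<1+X _ → <⇒≱ k<1+X X<k
  least> zero {X} p | no ¬p1+X = ⊥-elim (¬p1+X (subst P (+-identityʳ (suc X)) p))
  least> (suc d) {X} p | no ¬p1+X with least> d {suc X} (subst P (+-suc (suc X) d) p)
  ... | r , pr , 1+X<r , none = r , pr , <-trans (n<1+n X) 1+X<r , none′
    where
    none′ : ∀ k → X < k → k < r → ¬ P k
    none′ k X<k k<r with m≤n⇒m<n∨m≡n X<k
    ... | inj₁ 1+X<k = none k 1+X<k k<r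
    ... | inj₂ refl = ¬p1+X

  straddle : ∀ {a b} X → P a → a ≤ X → P b → X < b →
             ∃[ q ] ∃[ r ] (P q × P r × q ≤ X × X < r × (∀ k → q < k → k < r → ¬ P k))
  straddle {b = b} X pa a≤X pb X<b with greatest≤ X pa a≤X | least> (b ∸ suc X) (subst P (sym (m+[n∸m]≡n X<b)) pb)
  ... | q , pq , q≤X , noneBelow | r , pr , X<r , noneAbove = q , r , pq , pr , q≤X , X<r , none
    where
    none : ∀ k → q < k → k < r → ¬ P k
    none k q<k k<r with k ≤? X
    ... | yes k≤X = noneBelow k q<k k≤X
    ... | no k≰X = noneAbove k (≰⇒> k≰X) k<r

prime-factor : ∀ n → 1 < n → ∃[ p ] (Prime p × p ∣ n)
prime-factor n@(suc n-1) 1<n with factorise n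
... | record { factors = [] ; isFactorisation = n≡1 } = ⊥-elim (<⇒≢ 1<n (sym n≡1))
... | record { factors = p ∷ ps ; isFactorisation = n≡p*Πps ; factorsPrime = pp ∷ _ } =
  p , pp , subst (p ∣_) (sym n≡p*Πps) (m∣m*n _)

prime∣n!+1⇒n<p : ∀ {p} n → Prime p → p ∣ suc (n !) → n < p
prime∣n!+1⇒n<p {p@(suc p-1)} n pp p∣n!+1 with n <? p
... | yes n<p = n<p
... | no n≮p = ⊥-elim (¬prime[1] (subst Prime (∣1⇒≡1 p∣1) pp))
  where
  p∣n! : p ∣ n !
  p∣n! = ∣-trans (m∣m*n (p-1 !)) (m≤n⇒m!∣n! (≮⇒≥ n≮p))
  p∣1 : p ∣ 1
  p∣1 = ∣m+n∣m⇒∣n (subst (p ∣_) (+-comm 1 (n !)) p∣n!+1) p∣n!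

∃prime> : ∀ n → ∃[ p ] (Prime p × n < p)
∃prime> n with prime-factor (suc (n !)) (s≤s (1≤n! n))
... | p , pp , p∣n!+1 = p , pp , prime∣n!+1⇒n<p n pp p∣n!+1

consecutivePrimes-straddling : ∀ X → 2 ≤ X → ∃[ q ] ∃[ r ] (ConsecutivePrimes q r × q ≤ X × X < r)
consecutivePrimes-straddling X 2≤X with ∃prime> X
... | R , pR , X<R with straddle prime? X prime[2] 2≤X pR X<R
...   | q , r , pq , pr , q≤X , X<r , none = q , r , (pq , pr , ≤-<-trans q≤X X<r , none) , q≤X , X<r

-- With d ≥ 2C√q this reads r ≥ q + 2C√q + C² = (√q + C)².
gap⇒¬SqrtDiffLt : ∀ {r q C} d → d + (q + C * C) ≤ r → 4 * (C * C) * q ≤ d ^ 2 → ¬ SqrtDiffLt r q C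
gap⇒¬SqrtDiffLt d d+q+C²≤r _ (inj₁ r<q+C²) =
  <⇒≱ r<q+C² (m+n≤o⇒n≤o d d+q+C²≤r)
gap⇒¬SqrtDiffLt d d+q+C²≤r 4C²q≤d² (inj₂ e²<4C²q) =
  <⇒≱ e²<4C²q (≤-trans 4C²q≤d² (^-monoˡ-≤ 2 (m+n≤o⇒m≤o∸n d d+q+C²≤r)))

module _ (m : ℕ) where
  open +-*-Solver

  cube-expansion : (m + 1) ^ 3 ≡ 2 * (m * m) + (m ^ 3 + m) + (m * m + 2 * m + 1)
  cube-expansion = solve 1 (λ m → (m :+ con 1) :^ 3
                              := con 2 :* (m :* m) :+ (m :^ 3 :+ m) :+ (m :* m :+ con 2 :* m :+ con 1)) refl m

  square-of-2m² : (2 * (m * m)) ^ 2 ≡ 4 * m * m ^ 3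
  square-of-2m² = solve 1 (λ m → (con 2 :* (m :* m)) :^ 2 := con 4 :* m :* m :^ 3) refl m

cubeGap⇒¬SqrtDiffLt : ∀ {C m q r} → C * C ≤ m → q ≤ m ^ 3 → (m + 1) ^ 3 ≤ r → ¬ SqrtDiffLt r q C
cubeGap⇒¬SqrtDiffLt {C} {m} {q} {r} C²≤m q≤m³ [m+1]³≤r =
  gap⇒¬SqrtDiffLt {r} {q} {C} (2 * (m * m)) gap-fits gap-large
  where
  gap-fits : 2 * (m * m) + (q + C * C) ≤ r
  gap-fits = begin
    2 * (m * m) + (q + C * C)                           ≤⟨ +-monoʳ-≤ (2 * (m * m)) (+-mono-≤ q≤m³ C²≤m) ⟩
    2 * (m * m) + (m ^ 3 + m)                           ≤⟨ m≤m+n _ (m * m + 2 * m + 1) ⟩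
    2 * (m * m) + (m ^ 3 + m) + (m * m + 2 * m + 1)     ≡⟨ cube-expansion m ⟨
    (m + 1) ^ 3                                         ≤⟨ [m+1]³≤r ⟩
    r                                                   ∎
    where open ≤-Reasoning
  gap-large : 4 * (C * C) * q ≤ (2 * (m * m)) ^ 2
  gap-large = begin
    4 * (C * C) * q   ≤⟨ *-mono-≤ (*-monoʳ-≤ 4 C²≤m) q≤m³ ⟩
    4 * m * m ^ 3     ≡⟨ square-of-2m² m ⟨
    (2 * (m * m)) ^ 2 ∎
    where open ≤-Reasoning

theorem7 : (∃[ C ] (0 < C × (∀ q r → ConsecutivePrimes q r → SqrtDiffLt r q C)))
    → ∃[ M ] (0 < M × (∀ m → M < m → ∃[ p ] (Prime p × m ^ 3 < p × p < (m + 1) ^ 3)))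
theorem7 (C , 0<C , sqrtGap<C) = C * C , 0<C² , primeBetweenCubes
  where
  0<C² : 0 < C * C
  0<C² = *-mono-≤ 0<C 0<C
  2≤m³ : ∀ {m} → C * C < m → 2 ≤ m ^ 3
  2≤m³ C²<m = ≤-trans (s≤s (s≤s z≤n)) (^-monoˡ-≤ 3 (≤-trans (s≤s 0<C²) C²<m))
  primeBetweenCubes : ∀ m → C * C < m → ∃[ p ] (Prime p × m ^ 3 < p × p < (m + 1) ^ 3)
  primeBetweenCubes m C²<m with consecutivePrimes-straddling (m ^ 3) (2≤m³ C²<m)
  ... | q , r , cons@(_ , pr , _) , q≤m³ , m³<r with r <? (m + 1) ^ 3
  ...   | yes r<[m+1]³ = r , pr , m³<r , r<[m+1]³
  ...   | no r≮[m+1]³ = ⊥-elim (cubeGap⇒¬SqrtDiffLt {C} (<⇒≤ C²<m) q≤m³ (≮⇒≥ r≮[m+1]³) (sqrtGap<C q r cons))
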